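{- Let $\beta\in\mathbb{N}$ and $\lambda\ge2$ an integer, and let $H_n(\lambda,\beta,\gamma)$ denote the coefficient of $\frac{x^n}{n!}$ in $\frac{e^{\gamma x}}{(2-e^{\beta x})^{\lambda}}$. Then for every $n\in\mathbb{N}_0$, $$H_n(\lambda,\beta,\beta)=\frac12H_n(\lambda-1,\beta,\beta)+\frac{1}{2\beta(\lambda-1)}\sum_{i=0}^{n}\binom{n}{i}H_{i+1}(\lambda-1,\beta,0)\,\beta^{n-i}.$$ -}

module Defs where

open import Data.Nat as ℕ using (ℕ; zero; suc; _∸_; _≤ᵇ_)
open import Data.Nat.Combinatorics using (_C_)
open import Data.Integer using (+_)
open import Data.Rational using (ℚ; 0ℚ; 1ℚ; _+_; _*_; -_; _/_)
open import Data.Bool using (if_then_else_)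

toℚ : ℕ → ℚ
toℚ n = + n / 1

sumTo : ℕ → (ℕ → ℚ) → ℚ
sumTo zero    f = f 0
sumTo (suc n) f = sumTo n f + f (suc n)

sumFrom1 : ℕ → (ℕ → ℚ) → ℚ
sumFrom1 zero    f = 0ℚ
sumFrom1 (suc n) f = sumFrom1 n f + f (suc n)

-- Exponential formal power series over ℚ: a sequence f, representing
-- Σ_n f n · x^n / n!   (f n is the coefficient of x^n/n!)
EGF : Set
EGF = ℕ → ℚ

egfMul : EGF → EGF → EGF
egfMul f g n = sumTo n (λ i → toℚ (n C i) * (f i * g (n ∸ i)))

egfOne : EGF
egfOne zero    = 1ℚ
egfOne (suc _) = 0ℚ

egfExp : ℕ → EGF
egfExp c n = toℚ (c ℕ.^ n)

twoMinusExp : ℕ → EGF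
twoMinusExp β zero    = 1ℚ
twoMinusExp β (suc n) = - toℚ (β ℕ.^ suc n)

-- Multiplicative inverse of an EGF f with f 0 = 1 (the only case used):
-- g 0 = 1, g n = - Σ_{i=1}^{n} C(n,i) f i g (n-i), i.e. the unique g with f·g = 1.
-- invAux f n is a table whose entries at indices k ≤ n are g k.
invAux : EGF → ℕ → EGF
invAux f zero    = λ _ → 1ℚ
invAux f (suc n) = λ k → if k ≤ᵇ n then invAux f n k
  else - sumFrom1 (suc n) (λ i → toℚ (suc n C i) * (f i * invAux f n (suc n ∸ i)))

egfInv : EGF → EGF
egfInv f n = invAux f n n

egfPow : EGF → ℕ → EGF
egfPow f zero    = egfOne
egfPow f (suc k) = egfMul f (egfPow f k)

H : ℕ → ℕ → ℕ → ℕ → ℚ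
H n λ' β γ = egfMul (egfExp γ) (egfPow (egfInv (twoMinusExp β)) λ') n

-- Let E = e^{βx} and F = 1/(2 - E). Differentiating (2 - E)·F = 1 gives F′ = β·E·F², hence
-- (F^m)′ = mβ·E·F^{m+1}, and E·F = 2F - 1. With m = λ - 1, the sum on the right is the
-- coefficient of x^n/n! in (F^m)′·E = mβ·E·(E·F)·F^m = mβ·(2·E·F^λ - E·F^m), i.e. it equals
-- mβ·(2·H_n(λ,β,β) - H_n(λ-1,β,β)), which rearranges to the claimed identity.
module Submission where

open import Defs
open import Data.Nat as ℕ using (ℕ; zero; suc; z≤n; s≤s; _∸_; _<ᵇ_)
import Data.Nat.Properties as ℕ
open import Data.Nat.Combinatorics using (_C_; nCk+nC[k+1]≡[n+1]C[k+1]; k>n⇒nCk≡0)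
open import Data.Bool using (false)
open import Data.Bool.Properties using (T-≡)
open import Data.Integer as ℤ using (+_)
import Data.Integer.Properties as ℤ
open import Data.Rational using (ℚ; _+_; _*_; _/_; -_; 0ℚ; 1ℚ; ½; toℚᵘ)
open import Data.Rational.Properties
  using ( toℚᵘ-injective; toℚᵘ-fromℚᵘ; toℚᵘ-homo-+; toℚᵘ-homo-*; +-0-group
        ; +-comm; +-assoc; *-assoc; +-identityˡ; +-identityʳ; +-inverseˡ; *-identityˡ; *-identityʳ
        ; *-comm; *-zeroˡ; *-zeroʳ; *-distribʳ-+; neg-distribˡ-*)
open import Data.Rational.Solver using (module +-*-Solver)
open import Data.Rational.Unnormalised as ℚᵘ using (mkℚᵘ; *≡*; _≃_)
import Data.Rational.Unnormalised.Properties as ℚᵘ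
open import Algebra.Properties.Group +-0-group using (inverseʳ-unique)
open import Data.Sum using (inj₁; inj₂)
open import Function using (_∘_; Equivalence)
open import Relation.Binary.PropositionalEquality
import Relation.Binary.Reasoning.Setoid as SetoidReasoning

open +-*-Solver using (solve; _:+_; _:*_; _:=_; con; :-_)
module ≗-Reasoning = SetoidReasoning (ℕ →-setoid ℚ)

-- ℚ normalises by a gcd, which blocks computation, so facts about toℚ are transported from ℚᵘ.

toℚᵘ-toℚ : ∀ n → toℚᵘ (toℚ n) ≃ mkℚᵘ (+ n) 0
toℚᵘ-toℚ n = toℚᵘ-fromℚᵘ (mkℚᵘ (+ n) 0)

toℚ-+ : ∀ m n → toℚ (m ℕ.+ n) ≡ toℚ m + toℚ n
toℚ-+ m n = toℚᵘ-injective (begin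
  toℚᵘ (toℚ (m ℕ.+ n))              ≈⟨ toℚᵘ-toℚ (m ℕ.+ n) ⟩
  mkℚᵘ (+ (m ℕ.+ n)) 0              ≈⟨ *≡* eq ⟩
  mkℚᵘ (+ m) 0 ℚᵘ.+ mkℚᵘ (+ n) 0     ≈⟨ ℚᵘ.+-cong (toℚᵘ-toℚ m) (toℚᵘ-toℚ n) ⟨
  toℚᵘ (toℚ m) ℚᵘ.+ toℚᵘ (toℚ n)     ≈⟨ toℚᵘ-homo-+ (toℚ m) (toℚ n) ⟨
  toℚᵘ (toℚ m + toℚ n)              ∎)
  where
  open ℚᵘ.≃-Reasoning
  eq : + (m ℕ.+ n) ℤ.* + 1 ≡ (+ m ℤ.* + 1 ℤ.+ + n ℤ.* + 1) ℤ.* + 1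
  eq = cong (ℤ._* + 1)
    (trans (ℤ.pos-+ m n) (sym (cong₂ ℤ._+_ (ℤ.*-identityʳ (+ m)) (ℤ.*-identityʳ (+ n)))))

toℚ-* : ∀ m n → toℚ (m ℕ.* n) ≡ toℚ m * toℚ n
toℚ-* m n = toℚᵘ-injective (begin
  toℚᵘ (toℚ (m ℕ.* n))              ≈⟨ toℚᵘ-toℚ (m ℕ.* n) ⟩
  mkℚᵘ (+ (m ℕ.* n)) 0              ≈⟨ *≡* (cong (ℤ._* + 1) (ℤ.pos-* m n)) ⟩
  mkℚᵘ (+ m) 0 ℚᵘ.* mkℚᵘ (+ n) 0     ≈⟨ ℚᵘ.*-cong (toℚᵘ-toℚ m) (toℚᵘ-toℚ n) ⟨
  toℚᵘ (toℚ m) ℚᵘ.* toℚᵘ (toℚ n)     ≈⟨ toℚᵘ-homo-* (toℚ m) (toℚ n) ⟨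
  toℚᵘ (toℚ m * toℚ n)              ∎)
  where open ℚᵘ.≃-Reasoning

toℚ-inverseˡ : ∀ n .{{_ : ℕ.NonZero n}} → (+ 1 / n) * toℚ n ≡ 1ℚ
toℚ-inverseˡ n@(suc k) = toℚᵘ-injective (begin
  toℚᵘ ((+ 1 / n) * toℚ n)            ≈⟨ toℚᵘ-homo-* (+ 1 / n) (toℚ n) ⟩
  toℚᵘ (+ 1 / n) ℚᵘ.* toℚᵘ (toℚ n)     ≈⟨ ℚᵘ.*-cong (toℚᵘ-fromℚᵘ (mkℚᵘ (+ 1) k)) (toℚᵘ-toℚ n) ⟩
  mkℚᵘ (+ 1) k ℚᵘ.* mkℚᵘ (+ n) 0      ≈⟨ *≡* eq ⟩
  ℚᵘ.1ℚᵘ                             ∎)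
  where
  open ℚᵘ.≃-Reasoning
  eq : (+ 1 ℤ.* + n) ℤ.* + 1 ≡ + 1 ℤ.* + (n ℕ.* 1)
  eq = trans (ℤ.*-identityʳ (+ 1 ℤ.* + n)) (cong (λ d → + 1 ℤ.* + d) (sym (ℕ.*-identityʳ n)))

-- Finite sums

sumTo-cong : ∀ n {f g : ℕ → ℚ} → (∀ {i} → i ℕ.≤ n → f i ≡ g i) → sumTo n f ≡ sumTo n g
sumTo-cong zero    f≗g = f≗g z≤n
sumTo-cong (suc n) f≗g = cong₂ _+_ (sumTo-cong n (f≗g ∘ ℕ.m≤n⇒m≤1+n)) (f≗g ℕ.≤-refl)

sumTo-+ : ∀ n (f g : ℕ → ℚ) → sumTo n (λ i → f i + g i) ≡ sumTo n f + sumTo n g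
sumTo-+ zero    f g = refl
sumTo-+ (suc n) f g rewrite sumTo-+ n f g =
  solve 4 (λ a b c d → (a :+ b) :+ (c :+ d) := (a :+ c) :+ (b :+ d)) refl
    (sumTo n f) (sumTo n g) (f (suc n)) (g (suc n))

sumTo-*ˡ : ∀ n c (f : ℕ → ℚ) → sumTo n (λ i → c * f i) ≡ c * sumTo n f
sumTo-*ˡ zero    c f = refl
sumTo-*ˡ (suc n) c f rewrite sumTo-*ˡ n c f =
  solve 3 (λ c a b → c :* a :+ c :* b := c :* (a :+ b)) refl c (sumTo n f) (f (suc n))

sumTo-zero : ∀ n → sumTo n (λ _ → 0ℚ) ≡ 0ℚ
sumTo-zero zero = refl
sumTo-zero (suc n) rewrite sumTo-zero n = refl

sumTo-suc : ∀ n (f : ℕ → ℚ) → sumTo (suc n) f ≡ f 0 + sumTo n (f ∘ suc)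
sumTo-suc zero    f = refl
sumTo-suc (suc n) f rewrite sumTo-suc n f = +-assoc (f 0) _ _

sumTo-sumFrom1 : ∀ n (f : ℕ → ℚ) → sumTo n f ≡ f 0 + sumFrom1 n f
sumTo-sumFrom1 zero    f = sym (+-identityʳ (f 0))
sumTo-sumFrom1 (suc n) f rewrite sumTo-sumFrom1 n f = +-assoc (f 0) _ _

sumFrom1-cong : ∀ n {f g : ℕ → ℚ} → (∀ {i} → i ℕ.< n → f (suc i) ≡ g (suc i)) →
                sumFrom1 n f ≡ sumFrom1 n g
sumFrom1-cong zero    f≗g = refl
sumFrom1-cong (suc n) f≗g = cong₂ _+_ (sumFrom1-cong n (f≗g ∘ ℕ.m<n⇒m<1+n)) (f≗g ℕ.≤-refl)

-- Exponential generating functions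

infixl 6 _⊕_
infixl 7 _·_
infixr 8 _⋆_

_·_ : EGF → EGF → EGF
_·_ = egfMul

_⊕_ : EGF → EGF → EGF
(f ⊕ g) n = f n + g n

_⋆_ : ℚ → EGF → EGF
(c ⋆ f) n = c * f n

egfZero : EGF
egfZero _ = 0ℚ

-- On exponential generating functions, differentiation is the shift of coefficients.
∂ : EGF → EGF
∂ f n = f (suc n)

·-cong : ∀ {f f′ g g′} → f ≗ f′ → g ≗ g′ → f · g ≗ f′ · g′
·-cong f≗f′ g≗g′ n =
  sumTo-cong n (λ {i} _ → cong₂ (λ a b → toℚ (n C i) * (a * b)) (f≗f′ i) (g≗g′ (n ∸ i)))

·-congˡ : ∀ f {g g′} → g ≗ g′ → f · g ≗ f · g′
·-congˡ f = ·-cong {f} {f} (λ _ → refl)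

·-congʳ : ∀ g {f f′} → f ≗ f′ → f · g ≗ f′ · g
·-congʳ g f≗f′ = ·-cong {g = g} {g} f≗f′ (λ _ → refl)

⊕-cong : ∀ {f f′ g g′} → f ≗ f′ → g ≗ g′ → f ⊕ g ≗ f′ ⊕ g′
⊕-cong f≗f′ g≗g′ n = cong₂ _+_ (f≗f′ n) (g≗g′ n)

⋆-cong : ∀ c {f g} → f ≗ g → c ⋆ f ≗ c ⋆ g
⋆-cong c f≗g n = cong (c *_) (f≗g n)

⋆-assoc : ∀ a b f → a ⋆ (b ⋆ f) ≗ (a * b) ⋆ f
⋆-assoc a b f n = sym (*-assoc a b (f n))

·-distribʳ-⊕ : ∀ f g h → (f ⊕ g) · h ≗ f · h ⊕ g · h
·-distribʳ-⊕ f g h n = trans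
  (sumTo-cong n (λ {i} _ → solve 4 (λ c a b x → c :* ((a :+ b) :* x) := c :* (a :* x) :+ c :* (b :* x))
    refl (toℚ (n C i)) (f i) (g i) (h (n ∸ i))))
  (sumTo-+ n _ _)

·-distribˡ-⊕ : ∀ f g h → h · (f ⊕ g) ≗ h · f ⊕ h · g
·-distribˡ-⊕ f g h n = trans
  (sumTo-cong n (λ {i} _ → solve 4 (λ c a b x → c :* (x :* (a :+ b)) := c :* (x :* a) :+ c :* (x :* b))
    refl (toℚ (n C i)) (f (n ∸ i)) (g (n ∸ i)) (h i)))
  (sumTo-+ n _ _)

·-⋆ˡ : ∀ c f g → (c ⋆ f) · g ≗ c ⋆ (f · g)
·-⋆ˡ c f g n = trans
  (sumTo-cong n (λ {i} _ → solve 4 (λ k c a b → k :* ((c :* a) :* b) := c :* (k :* (a :* b)))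
    refl (toℚ (n C i)) c (f i) (g (n ∸ i))))
  (sumTo-*ˡ n c _)

·-⋆ʳ : ∀ c f g → f · (c ⋆ g) ≗ c ⋆ (f · g)
·-⋆ʳ c f g n = trans
  (sumTo-cong n (λ {i} _ → solve 4 (λ k c a b → k :* (a :* (c :* b)) := c :* (k :* (a :* b)))
    refl (toℚ (n C i)) c (f i) (g (n ∸ i))))
  (sumTo-*ˡ n c _)

·-zeroˡ : ∀ f → egfZero · f ≗ egfZero
·-zeroˡ f n = trans (sumTo-cong n (λ {i} _ → vanishes (toℚ (n C i)) (f (n ∸ i)))) (sumTo-zero n)
  where
  vanishes : ∀ x y → x * (0ℚ * y) ≡ 0ℚ
  vanishes x y = trans (cong (x *_) (*-zeroˡ y)) (*-zeroʳ x)

·-zeroth : ∀ f g → (f · g) 0 ≡ f 0 * g 0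
·-zeroth f g = *-identityˡ (f 0 * g 0)

-- The top term C(n, n+1) vanishes, so the sum may run to n + 1.
·-∂-extend : ∀ f g n → (f · ∂ g) n ≡ sumTo (suc n) (λ i → toℚ (n C i) * (f i * g (suc n ∸ i)))
·-∂-extend f g n = begin
  (f · ∂ g) n                    ≡⟨ sumTo-cong n (λ {i} i≤n → cong (λ k → toℚ (n C i) * (f i * g k))
                                                                 (sym (ℕ.+-∸-assoc 1 i≤n))) ⟩
  sumTo n h                      ≡⟨ +-identityʳ (sumTo n h) ⟨
  sumTo n h + 0ℚ                 ≡⟨ cong (λ x → sumTo n h + x) top-vanishes ⟨
  sumTo n h + h (suc n)          ∎
  where
  open ≡-Reasoning
  h : ℕ → ℚ
  h i = toℚ (n C i) * (f i * g (suc n ∸ i))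
  top-vanishes : h (suc n) ≡ 0ℚ
  top-vanishes = trans (cong (λ c → toℚ c * (f (suc n) * g (n ∸ n))) (k>n⇒nCk≡0 (ℕ.n<1+n n))) (*-zeroˡ (f (suc n) * g (n ∸ n)))

∂-· : ∀ f g → ∂ (f · g) ≗ ∂ f · g ⊕ f · ∂ g
∂-· f g n = begin
  sumTo (suc n) h                                   ≡⟨ sumTo-suc n h ⟩
  h 0 + sumTo n (λ i → toℚ (suc n C suc i) * t i)   ≡⟨ cong (λ x → h 0 + x) (sumTo-cong n (λ {i} _ → pascal i)) ⟩
  h 0 + sumTo n (λ i → A i + B i)                   ≡⟨ cong (λ x → h 0 + x) (sumTo-+ n A B) ⟩
  h 0 + (sumTo n A + sumTo n B)                     ≡⟨ solve 3 (λ x a b → x :+ (a :+ b) := a :+ (x :+ b))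
                                                         refl (h 0) (sumTo n A) (sumTo n B) ⟩
  sumTo n A + (h 0 + sumTo n B)                     ≡⟨ cong (λ x → sumTo n A + x) (trans (·-∂-extend f g n)
                                                                                (sumTo-suc n _)) ⟨
  (∂ f · g) n + (f · ∂ g) n                         ∎
  where
  open ≡-Reasoning
  h : ℕ → ℚ
  h i = toℚ (suc n C i) * (f i * g (suc n ∸ i))
  t A B : ℕ → ℚ
  t i = f (suc i) * g (n ∸ i)
  A i = toℚ (n C i) * t i
  B i = toℚ (n C suc i) * t i
  pascal : ∀ i → toℚ (suc n C suc i) * t i ≡ A i + B i
  pascal i = begin
    toℚ (suc n C suc i) * t i                  ≡⟨ cong (λ c → toℚ c * t i) (nCk+nC[k+1]≡[n+1]C[k+1] n i) ⟨
    toℚ (n C i ℕ.+ n C suc i) * t i            ≡⟨ cong (_* t i) (toℚ-+ (n C i) (n C suc i)) ⟩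
    (toℚ (n C i) + toℚ (n C suc i)) * t i      ≡⟨ *-distribʳ-+ (t i) (toℚ (n C i)) (toℚ (n C suc i)) ⟩
    A i + B i                                  ∎

·-comm : ∀ f g → f · g ≗ g · f
·-comm f g zero = trans (·-zeroth f g) (trans (*-comm (f 0) (g 0)) (sym (·-zeroth g f)))
·-comm f g (suc n) = begin
  (f · g) (suc n)              ≡⟨ ∂-· f g n ⟩
  (∂ f · g) n + (f · ∂ g) n    ≡⟨ cong₂ _+_ (·-comm (∂ f) g n) (·-comm f (∂ g) n) ⟩
  (g · ∂ f) n + (∂ g · f) n    ≡⟨ +-comm ((g · ∂ f) n) ((∂ g · f) n) ⟩
  (∂ g · f) n + (g · ∂ f) n    ≡⟨ ∂-· g f n ⟨
  (g · f) (suc n)              ∎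
  where open ≡-Reasoning

·-assoc : ∀ f g h → (f · g) · h ≗ f · (g · h)
·-assoc f g h zero =
  trans (·-zeroth (f · g) h) (trans (cong (_* h 0) (·-zeroth f g))
    (trans (*-assoc (f 0) (g 0) (h 0)) (sym (trans (·-zeroth f (g · h)) (cong (f 0 *_) (·-zeroth g h))))))
·-assoc f g h (suc n) = begin
  ((f · g) · h) (suc n)                                         ≡⟨ ∂-· (f · g) h n ⟩
  (∂ (f · g) · h) n + (f · g · ∂ h) n                           ≡⟨ cong (_+ (f · g · ∂ h) n)
                                                                     (trans (·-congʳ h (∂-· f g) n)
                                                                            (·-distribʳ-⊕ (∂ f · g) (f · ∂ g) h n)) ⟩
  ((∂ f · g · h) n + (f · ∂ g · h) n) + (f · g · ∂ h) n         ≡⟨ cong₂ _+_ (cong₂ _+_ (·-assoc (∂ f) g h n)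
                                                                                       (·-assoc f (∂ g) h n))
                                                                             (·-assoc f g (∂ h) n) ⟩
  ((∂ f · (g · h)) n + (f · (∂ g · h)) n) + (f · (g · ∂ h)) n   ≡⟨ +-assoc (((∂ f · (g · h)) n)) _ _ ⟩
  (∂ f · (g · h)) n + ((f · (∂ g · h)) n + (f · (g · ∂ h)) n)   ≡⟨ cong (λ x → (∂ f · (g · h)) n + x)
                                                                     (trans (·-congˡ f (∂-· g h) n)
                                                                            (·-distribˡ-⊕ (∂ g · h) (g · ∂ h) f n)) ⟨
  (∂ f · (g · h)) n + (f · ∂ (g · h)) n                         ≡⟨ ∂-· f (g · h) n ⟨
  (f · (g · h)) (suc n)                                         ∎
  where open ≡-Reasoning

·-identityˡ : ∀ f → egfOne · f ≗ f
·-identityˡ f zero = trans (·-zeroth egfOne f) (*-identityˡ (f 0))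
·-identityˡ f (suc n) = begin
  (egfOne · f) (suc n)                       ≡⟨ ∂-· egfOne f n ⟩
  (egfZero · f) n + (egfOne · ∂ f) n         ≡⟨ cong₂ _+_ (·-zeroˡ f n) (·-identityˡ (∂ f) n) ⟩
  0ℚ + f (suc n)                             ≡⟨ +-identityˡ (f (suc n)) ⟩
  f (suc n)                                  ∎
  where open ≡-Reasoning

·-swap : ∀ f g h → f · (g · h) ≗ g · (f · h)
·-swap f g h = begin
  f · (g · h)   ≈⟨ ·-assoc f g h ⟨
  f · g · h     ≈⟨ ·-congʳ h (·-comm f g) ⟩
  g · f · h     ≈⟨ ·-assoc g f h ⟩
  g · (f · h)   ∎
  where open ≗-Reasoning

∂-egfPow : ∀ f m → ∂ (egfPow f (suc m)) ≗ toℚ (suc m) ⋆ (∂ f · egfPow f m)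
∂-egfPow f zero n = begin
  ∂ (f · egfOne) n                     ≡⟨ ∂-· f egfOne n ⟩
  (∂ f · egfOne) n + (f · egfZero) n   ≡⟨ cong (λ x → (∂ f · egfOne) n + x)
                                             (trans (·-comm f egfZero n) (·-zeroˡ f n)) ⟩
  (∂ f · egfOne) n + 0ℚ                ≡⟨ +-identityʳ _ ⟩
  (∂ f · egfOne) n                     ≡⟨ *-identityˡ _ ⟨
  1ℚ * (∂ f · egfOne) n                ∎
  where open ≡-Reasoning
∂-egfPow f (suc m) n = begin
  ∂ (f · P) n                                  ≡⟨ ∂-· f P n ⟩
  (∂ f · P) n + (f · ∂ P) n                    ≡⟨ cong (λ x → (∂ f · P) n + x)
                                                    (trans (·-congˡ f (∂-egfPow f m) n)
                                                    (trans (·-⋆ʳ c f (∂ f · egfPow f m) n)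
                                                           (cong (c *_) (·-swap f (∂ f) (egfPow f m) n)))) ⟩
  (∂ f · P) n + c * (∂ f · P) n                ≡⟨ solve 2 (λ c x → x :+ c :* x := (con 1ℚ :+ c) :* x)
                                                    refl c ((∂ f · P) n) ⟩
  (1ℚ + c) * (∂ f · P) n                       ≡⟨ cong (_* (∂ f · P) n) (toℚ-+ 1 (suc m)) ⟨
  toℚ (suc (suc m)) * (∂ f · P) n              ∎
  where
  open ≡-Reasoning
  P : EGF
  P = egfPow f (suc m)
  c : ℚ
  c = toℚ (suc m)

-- Reciprocals of series with constant term 1

n<ᵇn≡false : ∀ n → (n <ᵇ n) ≡ false
n<ᵇn≡false zero    = refl
n<ᵇn≡false (suc n) = n<ᵇn≡false n

invAux-stable : ∀ f {n k} → k ℕ.≤ n → invAux f n k ≡ egfInv f k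
invAux-stable f {zero}      z≤n   = refl
invAux-stable f {suc n} {k} k≤1+n with ℕ.m≤n⇒m<n∨m≡n k≤1+n
... | inj₂ refl         = refl
... | inj₁ (s≤s k≤n) rewrite Equivalence.to T-≡ (ℕ.≤⇒≤ᵇ k≤n) = invAux-stable f k≤n

egfInv-suc : ∀ f m → egfInv f (suc m)
           ≡ - sumFrom1 (suc m) (λ i → toℚ (suc m C i) * (f i * egfInv f (suc m ∸ i)))
egfInv-suc f m rewrite n<ᵇn≡false m =
  cong -_ (sumFrom1-cong (suc m) (λ {i} _ →
    cong (λ x → toℚ (suc m C suc i) * (f (suc i) * x)) (invAux-stable f (ℕ.m∸n≤m m i))))

·-inverseʳ : ∀ f → f 0 ≡ 1ℚ → f · egfInv f ≗ egfOne
·-inverseʳ f f₀≡1 zero = trans (·-zeroth f (egfInv f)) (trans (*-identityʳ (f 0)) f₀≡1)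
·-inverseʳ f f₀≡1 (suc m) = begin
  (f · egfInv f) (suc m)      ≡⟨ sumTo-sumFrom1 (suc m) h ⟩
  h 0 + X                     ≡⟨ cong (_+ X) (trans (*-identityˡ _) (cong (_* egfInv f (suc m)) f₀≡1)) ⟩
  1ℚ * egfInv f (suc m) + X   ≡⟨ cong (_+ X) (trans (*-identityˡ _) (egfInv-suc f m)) ⟩
  - X + X                     ≡⟨ +-inverseˡ X ⟩
  0ℚ                          ∎
  where
  open ≡-Reasoning
  h : ℕ → ℚ
  h i = toℚ (suc m C i) * (f i * egfInv f (suc m ∸ i))
  X : ℚ
  X = sumFrom1 (suc m) h

∂-egfInv : ∀ f → f 0 ≡ 1ℚ → ∂ (egfInv f) ≗ (- 1ℚ) ⋆ (egfInv f · (egfInv f · ∂ f))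
∂-egfInv f f₀≡1 = begin
  ∂ g                            ≈⟨ ·-identityˡ (∂ g) ⟨
  egfOne · ∂ g                   ≈⟨ ·-congʳ (∂ g) (λ n → trans (·-comm g f n) (·-inverseʳ f f₀≡1 n)) ⟨
  g · f · ∂ g                    ≈⟨ ·-assoc g f (∂ g) ⟩
  g · (f · ∂ g)                  ≈⟨ ·-congˡ g f·∂g ⟩
  g · ((- 1ℚ) ⋆ (∂ f · g))       ≈⟨ ·-⋆ʳ (- 1ℚ) g (∂ f · g) ⟩
  (- 1ℚ) ⋆ (g · (∂ f · g))       ≈⟨ (λ n → cong ((- 1ℚ) *_) (·-congˡ g (·-comm (∂ f) g) n)) ⟩
  (- 1ℚ) ⋆ (g · (g · ∂ f))       ∎
  where
  open ≗-Reasoning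
  g : EGF
  g = egfInv f
  -- differentiate f · g = egfOne
  f·∂g : f · ∂ g ≗ (- 1ℚ) ⋆ (∂ f · g)
  f·∂g n = trans (inverseʳ-unique x ((f · ∂ g) n) (trans (sym (∂-· f g n)) (·-inverseʳ f f₀≡1 (suc n))))
                 (solve 1 (λ x → :- x := (:- con 1ℚ) :* x) refl x)
    where
    x : ℚ
    x = (∂ f · g) n

-- The series 1 / (2 - e^{βx})

egfExp-zero : egfExp 0 ≗ egfOne
egfExp-zero zero    = refl
egfExp-zero (suc n) = refl

∂-twoMinusExp : ∀ β → ∂ (twoMinusExp β) ≗ (- toℚ β) ⋆ egfExp β
∂-twoMinusExp β n = trans (cong -_ (toℚ-* β (β ℕ.^ n))) (neg-distribˡ-* (toℚ β) (toℚ (β ℕ.^ n)))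

egfExp≗2-twoMinusExp : ∀ β → egfExp β ≗ toℚ 2 ⋆ egfOne ⊕ (- 1ℚ) ⋆ twoMinusExp β
egfExp≗2-twoMinusExp β zero    = refl
egfExp≗2-twoMinusExp β (suc n) =
  solve 1 (λ x → x := con (toℚ 2) :* con 0ℚ :+ (:- con 1ℚ) :* (:- x)) refl (egfExp β (suc n))

invTwoMinusExp : ℕ → EGF
invTwoMinusExp β = egfInv (twoMinusExp β)

module _ (β : ℕ) where
  private
    E F : EGF
    E = egfExp β
    F = invTwoMinusExp β
    B : ℚ
    B = toℚ β

  ∂-invTwoMinusExp : ∂ F ≗ B ⋆ (E · (F · F))
  ∂-invTwoMinusExp = begin
    ∂ F                                    ≈⟨ ∂-egfInv (twoMinusExp β) refl ⟩
    (- 1ℚ) ⋆ (F · (F · ∂ (twoMinusExp β)))  ≈⟨ ⋆-cong (- 1ℚ) (·-congˡ F (·-congˡ F (∂-twoMinusExp β))) ⟩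
    (- 1ℚ) ⋆ (F · (F · ((- B) ⋆ E)))        ≈⟨ ⋆-cong (- 1ℚ) (λ n → trans (·-congˡ F (·-⋆ʳ (- B) F E) n)
                                                                           (·-⋆ʳ (- B) F (F · E) n)) ⟩
    (- 1ℚ) ⋆ ((- B) ⋆ (F · (F · E)))        ≈⟨ (λ n → solve 2 (λ b x → (:- con 1ℚ) :* ((:- b) :* x) := b :* x)
                                                        refl B ((F · (F · E)) n)) ⟩
    B ⋆ (F · (F · E))                      ≈⟨ ⋆-cong B (λ n → trans (·-congˡ F (·-comm F E) n) (·-swap F E F n)) ⟩
    B ⋆ (E · (F · F))                      ∎
    where open ≗-Reasoning

  egfExp·invTwoMinusExp : E · F ≗ toℚ 2 ⋆ F ⊕ (- 1ℚ) ⋆ egfOne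
  egfExp·invTwoMinusExp = begin
    E · F                                                        ≈⟨ ·-congʳ F (egfExp≗2-twoMinusExp β) ⟩
    (toℚ 2 ⋆ egfOne ⊕ (- 1ℚ) ⋆ twoMinusExp β) · F                ≈⟨ ·-distribʳ-⊕ (toℚ 2 ⋆ egfOne) ((- 1ℚ) ⋆ twoMinusExp β) F ⟩
    (toℚ 2 ⋆ egfOne) · F ⊕ ((- 1ℚ) ⋆ twoMinusExp β) · F          ≈⟨ ⊕-cong (·-⋆ˡ (toℚ 2) egfOne F)
                                                                             (·-⋆ˡ (- 1ℚ) (twoMinusExp β) F) ⟩
    toℚ 2 ⋆ (egfOne · F) ⊕ (- 1ℚ) ⋆ (twoMinusExp β · F)          ≈⟨ ⊕-cong (⋆-cong (toℚ 2) (·-identityˡ F))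
                                                                             (⋆-cong (- 1ℚ) (·-inverseʳ (twoMinusExp β) refl)) ⟩
    toℚ 2 ⋆ F ⊕ (- 1ℚ) ⋆ egfOne                                  ∎
    where open ≗-Reasoning

  ∂-invTwoMinusExp-pow : ∀ m → ∂ (egfPow F (suc m)) ≗ (toℚ (suc m) * B) ⋆ (E · egfPow F (suc (suc m)))
  ∂-invTwoMinusExp-pow m = begin
    ∂ (egfPow F (suc m))                              ≈⟨ ∂-egfPow F m ⟩
    toℚ (suc m) ⋆ (∂ F · egfPow F m)                  ≈⟨ ⋆-cong (toℚ (suc m)) (λ n →
                                                           trans (·-congʳ (egfPow F m) ∂-invTwoMinusExp n)
                                                                 (·-⋆ˡ B (E · (F · F)) (egfPow F m) n)) ⟩
    toℚ (suc m) ⋆ (B ⋆ (E · (F · F) · egfPow F m))    ≈⟨ ⋆-assoc (toℚ (suc m)) B _ ⟩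
    (toℚ (suc m) * B) ⋆ (E · (F · F) · egfPow F m)    ≈⟨ ⋆-cong (toℚ (suc m) * B) (λ n →
                                                           trans (·-assoc E (F · F) (egfPow F m) n)
                                                                 (·-congˡ E (·-assoc F F (egfPow F m)) n)) ⟩
    (toℚ (suc m) * B) ⋆ (E · egfPow F (suc (suc m)))  ∎
    where open ≗-Reasoning

  ∂-invTwoMinusExp-pow·egfExp : ∀ m →
    ∂ (egfExp 0 · egfPow F (suc m)) · E
      ≗ (toℚ (suc m) * B) ⋆ (toℚ 2 ⋆ (E · egfPow F (suc (suc m))) ⊕ (- 1ℚ) ⋆ (E · egfPow F (suc m)))
  ∂-invTwoMinusExp-pow·egfExp m = begin
    ∂ (egfExp 0 · G) · E                          ≈⟨ ·-congʳ E (λ n → trans (·-congʳ G egfExp-zero (suc n))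
                                                                            (·-identityˡ G (suc n))) ⟩
    ∂ G · E                                       ≈⟨ ·-congʳ E (∂-invTwoMinusExp-pow m) ⟩
    (k ⋆ (E · (F · G))) · E                       ≈⟨ ·-⋆ˡ k (E · (F · G)) E ⟩
    k ⋆ (E · (F · G) · E)                         ≈⟨ ⋆-cong k (λ n → trans (·-comm (E · (F · G)) E n)
                                                                          (sym (·-congˡ E (·-assoc E F G) n))) ⟩
    k ⋆ (E · (E · F · G))                         ≈⟨ ⋆-cong k (·-congˡ E (·-congʳ G egfExp·invTwoMinusExp)) ⟩
    k ⋆ (E · ((toℚ 2 ⋆ F ⊕ (- 1ℚ) ⋆ egfOne) · G))  ≈⟨ ⋆-cong k (·-congˡ E (λ n →
                                                        trans (·-distribʳ-⊕ (toℚ 2 ⋆ F) ((- 1ℚ) ⋆ egfOne) G n)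
                                                              (cong₂ _+_ (·-⋆ˡ (toℚ 2) F G n)
                                                                         (trans (·-⋆ˡ (- 1ℚ) egfOne G n)
                                                                                (⋆-cong (- 1ℚ) (·-identityˡ G) n))))) ⟩
    k ⋆ (E · (toℚ 2 ⋆ (F · G) ⊕ (- 1ℚ) ⋆ G))      ≈⟨ ⋆-cong k (λ n →
                                                        trans (·-distribˡ-⊕ (toℚ 2 ⋆ (F · G)) ((- 1ℚ) ⋆ G) E n)
                                                              (cong₂ _+_ (·-⋆ʳ (toℚ 2) E (F · G) n)
                                                                         (·-⋆ʳ (- 1ℚ) E G n))) ⟩
    k ⋆ (toℚ 2 ⋆ (E · (F · G)) ⊕ (- 1ℚ) ⋆ (E · G)) ∎
    where
    open ≗-Reasoning
    G : EGF
    G = egfPow F (suc m)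
    k : ℚ
    k = toℚ (suc m) * B

1/[2bm]*[2*[m*b]]≡1 : ∀ b m .{{_ : ℕ.NonZero (2 ℕ.* b ℕ.* m)}} →
                      (+ 1 / (2 ℕ.* b ℕ.* m)) * (toℚ 2 * (toℚ m * toℚ b)) ≡ 1ℚ
1/[2bm]*[2*[m*b]]≡1 b m = begin
  c * (toℚ 2 * (toℚ m * toℚ b))   ≡⟨ cong (c *_) (solve 3 (λ t m b → t :* (m :* b) := (t :* b) :* m)
                                                         refl (toℚ 2) (toℚ m) (toℚ b)) ⟩
  c * ((toℚ 2 * toℚ b) * toℚ m)   ≡⟨ cong (λ v → c * (v * toℚ m)) (toℚ-* 2 b) ⟨
  c * (toℚ (2 ℕ.* b) * toℚ m)     ≡⟨ cong (c *_) (toℚ-* (2 ℕ.* b) m) ⟨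
  c * toℚ (2 ℕ.* b ℕ.* m)         ≡⟨ toℚ-inverseˡ (2 ℕ.* b ℕ.* m) ⟩
  1ℚ                              ∎
  where
  open ≡-Reasoning
  c : ℚ
  c = + 1 / (2 ℕ.* b ℕ.* m)

½*y+c*[k*[2x-y]]≡x : ∀ c k x y → c * (toℚ 2 * k) ≡ 1ℚ → ½ * y + c * (k * (toℚ 2 * x + (- 1ℚ) * y)) ≡ x
½*y+c*[k*[2x-y]]≡x c k x y c2k≡1 = begin
  ½ * y + c * (k * (toℚ 2 * x + (- 1ℚ) * y))          ≡⟨ solve 4 (λ c k x y →
                                                          con ½ :* y :+ c :* (k :* (con (toℚ 2) :* x :+ (:- con 1ℚ) :* y))
                                                          := (c :* (con (toℚ 2) :* k)) :* x
                                                             :+ con ½ :* (con 1ℚ :+ (:- con 1ℚ) :* (c :* (con (toℚ 2) :* k))) :* y)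
                                                          refl c k x y ⟩
  u * x + ½ * (1ℚ + (- 1ℚ) * u) * y                   ≡⟨ cong (λ v → v * x + ½ * (1ℚ + (- 1ℚ) * v) * y) c2k≡1 ⟩
  1ℚ * x + ½ * (1ℚ + (- 1ℚ) * 1ℚ) * y                 ≡⟨ solve 2 (λ x y → con 1ℚ :* x :+ con ½ :* (con 1ℚ :+ (:- con 1ℚ) :* con 1ℚ) :* y := x) refl x y ⟩
  x                                                   ∎
  where
  open ≡-Reasoning
  u : ℚ
  u = c * (toℚ 2 * k)

theorem7 : (b l n : ℕ) →
    H n (suc (suc l)) (suc b) (suc b)
      ≡ ½ * H n (suc l) (suc b) (suc b)
        + (+ 1 / (2 ℕ.* suc b ℕ.* suc l))
          * sumTo n (λ i → toℚ (n C i) * (H (suc i) (suc l) (suc b) 0 * toℚ (suc b ℕ.^ (n ℕ.∸ i))))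
theorem7 b l n = sym (begin
  ½ * Y + c * (∂ (egfExp 0 · G) · egfExp β) n    ≡⟨ cong (λ s → ½ * Y + c * s)
                                                       (∂-invTwoMinusExp-pow·egfExp β l n) ⟩
  ½ * Y + c * (k * (toℚ 2 * X + (- 1ℚ) * Y))     ≡⟨ ½*y+c*[k*[2x-y]]≡x c k X Y (1/[2bm]*[2*[m*b]]≡1 β (suc l)) ⟩
  X                                              ∎)
  where
  open ≡-Reasoning
  β : ℕ
  β = suc b
  G : EGF
  G = egfPow (invTwoMinusExp β) (suc l)
  X Y c k : ℚ
  X = H n (suc (suc l)) β β
  Y = H n (suc l) β β
  c = + 1 / (2 ℕ.* β ℕ.* suc l)
  k = toℚ (suc l) * toℚ β
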